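{- Within a single pairing round of a delete-min on a multipass pairing heap with $n$ nodes, there are at most $O(\log n)$ links of type (1) or type (2).
   Context: Multipass pairing heap: a heap-ordered multi-ary tree (distinct keys) viewed as a binary tree (leftmost child = left child, next sibling = right child). Delete-min removes the root and repeatedly performs pairing rounds on the top-level nodes $x_1,\dots,x_\ell$ (a path of right-child pointers in the binary view), linking $x_{2i-1}$ with $x_{2i}$ for $1\le i\le\lfloor\ell/2\rfloor$; $\mathsf{link}$ makes the node with larger key the leftmost child of the other. For $\mathsf{link}(x,y)$ with $y$ the right child of $x$ in the binary view, let $a,b,c$ be the sizes of the left subtree of $x$, the left subtree of $y$, and the right subtree of $y$, respectively. With $\gamma=3000$, the link is of type (1) if $\gamma^2a\ge\max\{\gamma b,c\}$ and of type (2) if $\gamma b\ge\max\{\gamma^2 a,c\}$ (ties broken arbitrarily). -}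

module Defs where

open import Data.Nat using (ℕ; zero; suc; _+_; _*_; _≤_; _<_; _⊔_)
open import Data.Nat.Properties using (_≤?_)
open import Data.List using (List; []; _∷_; _++_)
open import Data.List.Relation.Unary.All using (All)
open import Data.Product using (_×_)
open import Data.Sum using (_⊎_)
open import Relation.Nullary using (Dec; does)
open import Relation.Nullary.Decidable using (_×-dec_; _⊎-dec_)
open import Data.Bool using (if_then_else_)

-- Multi-ary heap tree: a node with a key and its list of children
-- (leftmost child first).  In the binary view, the left subtree of a node
-- consists of its children (with their subtrees); the right subtree of a
-- top-level node x_i consists of x_{i+1},...,x_ℓ with their subtrees.
data Tree : Set where
  node : ℕ → List Tree → Tree

key : Tree → ℕ
key (node k _) = k

mutual
  size : Tree → ℕ
  size (node _ cs) = suc (sizeF cs)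

  sizeF : List Tree → ℕ
  sizeF [] = 0
  sizeF (t ∷ ts) = size t + sizeF ts

mutual
  keys : Tree → List ℕ
  keys (node k cs) = k ∷ keysF cs

  keysF : List Tree → List ℕ
  keysF [] = []
  keysF (t ∷ ts) = keys t ++ keysF ts

mutual
  data HeapOrdered : Tree → Set where
    node : ∀ {k cs} → All (λ c → k < key c) cs → HeapOrderedF cs →
           HeapOrdered (node k cs)

  data HeapOrderedF : List Tree → Set where
    []  : HeapOrderedF []
    _∷_ : ∀ {t ts} → HeapOrdered t → HeapOrderedF ts → HeapOrderedF (t ∷ ts)

leftSize : Tree → ℕ
leftSize (node _ cs) = sizeF cs

γ : ℕ
γ = 3000

-- link(x,y) with a = |left(x)|, b = |left(y)|, c = |right(y)|
Type1 : ℕ → ℕ → ℕ → Set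
Type1 a b c = (γ * b) ⊔ c ≤ γ * γ * a

Type2 : ℕ → ℕ → ℕ → Set
Type2 a b c = (γ * γ * a) ⊔ c ≤ γ * b

type12? : ∀ a b c → Dec (Type1 a b c ⊎ Type2 a b c)
type12? a b c = ((γ * b) ⊔ c ≤? γ * γ * a) ⊎-dec ((γ * γ * a) ⊔ c ≤? γ * b)

-- Number of links of type (1) or type (2) in one pairing round on the
-- top-level nodes x_1,...,x_ℓ: link(x_{2i-1}, x_{2i}) for i ≤ ⌊ℓ/2⌋, where
-- the right subtree of x_{2i} consists of x_{2i+1},...,x_ℓ and their subtrees.
roundType12Count : List Tree → ℕ
roundType12Count (x ∷ y ∷ rest) =
  (if does (type12? (leftSize x) (leftSize y) (sizeF rest)) then 1 else 0)
  + roundType12Count rest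
roundType12Count _ = 0

module Submission where

-- Put K = γ².  If link(x,y) has type (1) or (2) and c is the size
-- of the forest following y, then c ≤ K(a+b), so the forest remaining after
-- this pair has shrunk by a factor K/(K+1):  (K+1)·c ≤ K·(size before the pair).
--
-- We show by induction on p that a round on a forest of size < 2^p contains at
-- most (K+1)·p such links.  For the step from p to p+1 set B = 2^p.  Start with
-- the budget K·size < 2K·B and walk along the pairs.  As long as the remaining
-- forest has size ≥ B, every type (1)/(2) link lowers K·(remaining size) by at
-- least B (the shrinking above), i.e. it spends one of K units of budget; once
-- the remaining size drops below B the induction hypothesis applies.  Hence at
-- most K + 1 + (K+1)·p links in total.  The theorem follows with
-- p = 1 + ⌊log₂ (n+1)⌋.

open import Defs
open import Data.Nat using (ℕ; NonZero; zero; suc; _+_; _*_; _≤_; _<_; _^_; z≤n; s≤s)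
open import Data.Nat.Properties
open import Data.Nat.Logarithm using (⌊log₂_⌋; ⌊log₂⌋-mono-≤; ⌊log₂[2^n]⌋≡n)
open import Data.List using (List; []; _∷_)
open import Data.List.Relation.Unary.Unique.Propositional using (Unique)
open import Data.Product using (∃; _,_)
open import Data.Sum using (_⊎_; inj₁; inj₂)
open import Data.Empty using (⊥-elim)
open import Relation.Nullary using (Dec; does; yes; no)
open import Data.Bool using (if_then_else_)
open import Relation.Binary.PropositionalEquality using (_≡_; refl; sym; cong; subst; module ≡-Reasoning)

<2^suc⌊log₂⌋ : ∀ n → n < 2 ^ suc ⌊log₂ n ⌋
<2^suc⌊log₂⌋ n with 2 ^ suc ⌊log₂ n ⌋ ≤? n
... | yes big = ⊥-elim (n≮n ⌊log₂ n ⌋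
        (subst (_≤ ⌊log₂ n ⌋) (⌊log₂[2^n]⌋≡n (suc ⌊log₂ n ⌋)) (⌊log₂⌋-mono-≤ big)))
... | no small = ≰⇒> small

-- The shrinking ratio of links of type (1) and (2).  It is kept opaque: the
-- unfolding of K * n for a variable n would take γ² reduction steps.
opaque
  K : ℕ
  K = γ * γ

  K≡γ² : K ≡ γ * γ
  K≡γ² = refl

  instance
    K-nonZero : NonZero K
    K-nonZero = _

type12⇒right≤ : ∀ {a b c} → Type1 a b c ⊎ Type2 a b c → c ≤ K * (a + b)
type12⇒right≤ {a} {b} {c} (inj₁ type1) = begin
  c           ≤⟨ m⊔n≤o⇒n≤o (γ * b) c type1 ⟩
  γ * γ * a   ≡⟨ cong (_* a) K≡γ² ⟨
  K * a       ≤⟨ *-monoʳ-≤ K (m≤m+n a b) ⟩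
  K * (a + b) ∎
  where open ≤-Reasoning
type12⇒right≤ {a} {b} {c} (inj₂ type2) = begin
  c           ≤⟨ m⊔n≤o⇒n≤o (γ * γ * a) c type2 ⟩
  γ * b       ≤⟨ *-monoʳ-≤ γ (m≤n*m b γ) ⟩
  γ * (γ * b) ≡⟨ *-assoc γ γ b ⟨
  γ * γ * b   ≡⟨ cong (_* b) K≡γ² ⟨
  K * b       ≤⟨ *-monoʳ-≤ K (m≤n+m b a) ⟩
  K * (a + b) ∎
  where open ≤-Reasoning

link12-shrinks : ∀ x y rest →
  Type1 (leftSize x) (leftSize y) (sizeF rest) ⊎ Type2 (leftSize x) (leftSize y) (sizeF rest) →
  suc K * sizeF rest ≤ K * sizeF (x ∷ y ∷ rest)
link12-shrinks (node _ xs) (node _ ys) rest type12 = begin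
  suc K * c             ≡⟨⟩
  c + K * c             ≤⟨ +-monoˡ-≤ (K * c) (type12⇒right≤ {a} {b} {c} type12) ⟩
  K * (a + b) + K * c   ≡⟨ *-distribˡ-+ K (a + b) c ⟨
  K * (a + b + c)       ≡⟨ cong (K *_) (+-assoc a b c) ⟩
  K * (a + (b + c))     ≤⟨ *-monoʳ-≤ K (+-mono-≤ (n≤1+n a) (n≤1+n (b + c))) ⟩
  K * (suc a + (suc b + c)) ∎
  where
  -- a, b, c are passed to type12⇒right≤ explicitly: inferring them would make
  -- the unifier unfold the products γ·γ·a inside Type1/Type2.
  open ≤-Reasoning
  a b c : ℕ
  a = sizeF xs
  b = sizeF ys
  c = sizeF rest

suffix-size≤ : ∀ x y rest → sizeF rest ≤ sizeF (x ∷ y ∷ rest)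
suffix-size≤ x y rest = ≤-trans (m≤n+m (sizeF rest) (size y)) (m≤n+m _ (size x))

-- Case analysis on whether the first link of a round is counted.  Done by a
-- separate lemma over an abstract decision so that the (huge) arithmetic in
-- the type-(1)/(2) test is never normalised.
indicator+≤ : ∀ {A : Set} (d : Dec A) {n T : ℕ} → n ≤ T → (A → suc n ≤ T) →
              (if does d then 1 else 0) + n ≤ T
indicator+≤ (yes a) _ counted = counted a
indicator+≤ (no _) uncounted _ = uncounted

pay-for-link : ∀ {B c S} → B ≤ c → suc K * c ≤ K * S → B + K * c ≤ K * S
pay-for-link {B} {c} B≤c shrink = ≤-trans (+-monoˡ-≤ (K * c) B≤c) shrink

-- Suppose every round on a forest of size < B has at most
-- L links of type (1)/(2).  Then a round on a forest whose size satisfies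
-- K·size < (K+j)·B has at most j + 1 + L of them: each link performed while the
-- remaining size is ≥ B spends one of the j units of budget.
module Budget (B L : ℕ) (below : ∀ ts → sizeF ts < B → roundType12Count ts ≤ L) where

  mutual
    spend : ∀ ts j → K * sizeF ts < (K + j) * B → roundType12Count ts ≤ suc (j + L)
    spend [] j _ = z≤n
    spend (_ ∷ []) j _ = z≤n
    spend (x ∷ y ∷ rest) j budget =
      indicator+≤ (type12? (leftSize x) (leftSize y) (sizeF rest))
        (spend rest j (≤-<-trans (*-monoʳ-≤ K (suffix-size≤ x y rest)) budget))
        (λ type12 → s≤s (afterLink rest j (link12-shrinks x y rest type12) budget))

    afterLink : ∀ rest j {S} → suc K * sizeF rest ≤ K * S → K * S < (K + j) * B →
                roundType12Count rest ≤ j + L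
    afterLink rest j shrink budget with sizeF rest <? B
    ... | yes small = ≤-trans (below rest small) (m≤n+m L j)
    -- With no budget left, a remaining forest of size ≥ B is impossible.
    afterLink rest zero {S} shrink budget | no big = ⊥-elim (<-irrefl refl (begin-strict
      K * B       ≤⟨ *-monoʳ-≤ K (≮⇒≥ big) ⟩
      K * c       ≤⟨ m≤n+m (K * c) B ⟩
      B + K * c   ≤⟨ pay-for-link (≮⇒≥ big) shrink ⟩
      K * S       <⟨ budget ⟩
      (K + 0) * B ≡⟨ cong (_* B) (+-identityʳ K) ⟩
      K * B       ∎))
      where
      open ≤-Reasoning
      c : ℕ
      c = sizeF rest
    afterLink rest (suc j) {S} shrink budget | no big =
      spend rest j (+-cancelˡ-< B (K * c) ((K + j) * B) (begin-strict
        B + K * c       ≤⟨ pay-for-link (≮⇒≥ big) shrink ⟩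
        K * S           <⟨ budget ⟩
        (K + suc j) * B ≡⟨ cong (_* B) (+-suc K j) ⟩
        B + (K + j) * B ∎))
      where
      open ≤-Reasoning
      c : ℕ
      c = sizeF rest

double-budget : ∀ p → K * 2 ^ suc p ≡ (K + K) * 2 ^ p
double-budget p = begin
  K * (2 ^ p + (2 ^ p + 0)) ≡⟨ *-distribˡ-+ K (2 ^ p) (2 ^ p + 0) ⟩
  K * 2 ^ p + K * (2 ^ p + 0) ≡⟨ cong (λ m → K * 2 ^ p + K * m) (+-identityʳ (2 ^ p)) ⟩
  K * 2 ^ p + K * 2 ^ p     ≡⟨ *-distribʳ-+ (2 ^ p) K K ⟨
  (K + K) * 2 ^ p           ∎
  where open ≡-Reasoning

count≤ : ∀ p ts → sizeF ts < 2 ^ p → roundType12Count ts ≤ suc K * p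
count≤ zero [] _ = z≤n
count≤ zero (node _ _ ∷ _) (s≤s ())
count≤ (suc p) ts small = subst (roundType12Count ts ≤_) (sym (*-suc (suc K) p))
  (Budget.spend (2 ^ p) (suc K * p) (count≤ p) ts K
    (subst (K * sizeF ts <_) (double-budget p) (*-monoʳ-< K small)))

lemma4 : ∃ λ (C : ℕ) → (ts : List Tree) → HeapOrderedF ts → Unique (keysF ts) →
           roundType12Count ts ≤ C * (1 + ⌊log₂ (suc (sizeF ts)) ⌋)
lemma4 = suc K , λ ts _ _ → count≤ (suc ⌊log₂ (suc (sizeF ts)) ⌋) ts
  (<-trans (n<1+n (sizeF ts)) (<2^suc⌊log₂⌋ (suc (sizeF ts))))
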